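{- Let $p$ be an odd prime, $q=p^e$ with $e\ge1$, $k$ an integer with $0\le k\le p-1$, and $l_1,l_2,l_3$ non-negative integers. Then $D_{p^{l_1}+p^{l_2}+p^{l_3},k}(1,x)$ is a permutation polynomial of $\mathbb{F}_q$ if and only if \[k\,x^{\frac{p^{l_1}+p^{l_2}+p^{l_3}-1}{2}}+(2-k)\Big[x^{\frac{p^{l_1}+p^{l_2}}{2}}+x^{\frac{p^{l_1}+p^{l_3}}{2}}+x^{\frac{p^{l_2}+p^{l_3}}{2}}\Big]+k\Big[x^{\frac{p^{l_1}-1}{2}}+x^{\frac{p^{l_2}-1}{2}}+x^{\frac{p^{l_3}-1}{2}}\Big]\] is a permutation polynomial of $\mathbb{F}_q$.
   Context: For an odd prime $p$ and $0\le k\le p-1$: for $n\ge 1$, $D_{n,k}(1,x)=\sum_{i=0}^{\lfloor n/2\rfloor}\frac{n-ki}{n-i}\binom{n-i}{i}(-x)^i$, where the coefficient is the integer $\binom{n-i}{i}-(k-1)\binom{n-i-1}{i-1}$ (with $\binom{m}{ -1}=0$) viewed in $\mathbb{F}_p$; $D_{0,k}(1,x)=2-k$. Equivalently $D_{1,k}=1$ and $D_{n,k}=D_{n-1,k}-xD_{n-2,k}$ for $n\ge2$. A polynomial over $\mathbb{F}_q$ is a permutation polynomial of $\mathbb{F}_q$ if it induces a bijection of $\mathbb{F}_q$. Here $x^0$ means $1$. -}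

module Defs where

open import Level using (Level; _⊔_)
open import Data.Nat using (ℕ; zero; suc)
open import Data.Fin using (Fin)
open import Data.Product using (Σ; ∃; _×_)
open import Relation.Nullary using (¬_)
open import Algebra.Bundles using (CommutativeRing)
open import Function.Bundles using (Bijection)
import Relation.Binary.PropositionalEquality as ≡
import Data.Nat as ℕ
import Data.Nat.DivMod as ℕ

module _ {c ℓ : Level} (R : CommutativeRing c ℓ) where
  open CommutativeRing R

  IsFieldRing : Set (c ⊔ ℓ)
  IsFieldRing = (¬ (0# ≈ 1#)) × (∀ x → ¬ (x ≈ 0#) → ∃ λ y → x * y ≈ 1#)

  HasCard : ℕ → Set (c ⊔ ℓ)
  HasCard q = Bijection (≡.setoid (Fin q)) setoid

  natR : ℕ → Carrier
  natR zero = 0#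
  natR (suc n) = 1# + natR n

  pow : Carrier → ℕ → Carrier
  pow x zero = 1#
  pow x (suc n) = x * pow x n

  IsPermutationPoly : (Carrier → Carrier) → Set (c ⊔ ℓ)
  IsPermutationPoly f = (∀ x y → f x ≈ f y → x ≈ y) × (∀ y → ∃ λ x → f x ≈ y)

  D : ℕ → ℕ → Carrier → Carrier
  D zero k x = natR 2 - natR k
  D (suc zero) k x = 1#
  D (suc (suc n)) k x = D (suc n) k x - x * D n k x

  -- k x^{(n-1)/2} + (2-k)[x^{(a+b)/2} + x^{(a+c)/2} + x^{(b+c)/2}] + k[x^{(a-1)/2} + x^{(b-1)/2} + x^{(c-1)/2}]
  -- with a = p^{l₁}, b = p^{l₂}, c = p^{l₃}, n = a + b + c (exponents are exact halves since p is odd)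
  G : ℕ → ℕ → ℕ → ℕ → Carrier → Carrier
  G k a b c x =
    natR k * pow x ((a ℕ.+ b ℕ.+ c ℕ.∸ 1) ℕ./ 2)
    + (natR 2 - natR k) * (pow x ((a ℕ.+ b) ℕ./ 2) + pow x ((a ℕ.+ c) ℕ./ 2) + pow x ((b ℕ.+ c) ℕ./ 2))
    + natR k * (pow x ((a ℕ.∸ 1) ℕ./ 2) + pow x ((b ℕ.∸ 1) ℕ./ 2) + pow x ((c ℕ.∸ 1) ℕ./ 2))

module Submission where

-- Put t = 1 - 4x and work in Q = R[s]/(s² - t), with w = 1 + s.  Writing
-- w^n = A_n + B_n s, the recurrence of D gives the Binet-type formula
--     2^n D_{n,k}(x) = (2 - k) A_n + k B_n.
-- Since R has characteristic p, the Frobenius map z ↦ z^p is additive on Q, so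
-- w^{p^l} = 1 + s^{p^l} = 1 + t^δ s where p^l = 2δ + 1.  Multiplying the three
-- factors and reading off A_n and B_n yields the polynomial identity
--     2^n D_{n,k}(x) = (2 - k) + G(1 - 4x).
-- As p is odd, 2^n is a unit and x ↦ 1 - 4x is a bijection of R, so D_{n,k} is a
-- permutation polynomial iff G is.

open import Level using (Level)
open import Algebra.Bundles using (CommutativeRing; CommutativeSemiring)
open import Data.Nat as ℕ using (ℕ; zero; suc)
import Data.Nat.Properties as ℕP
open import Data.Nat.Primality using (Prime)
open import Data.Integer as ℤ using (ℤ; +_; -[1+_]; _⊖_; sign; ∣_∣; _◃_)
import Data.Integer.Properties as ℤP
open import Data.Sign as Sign using (Sign)
open import Data.Maybe using (Maybe; just; nothing)
open import Data.Product using (_×_; _,_; proj₁; proj₂; ∃)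
open import Data.Sum using (_⊎_; inj₁; inj₂)
open import Data.Empty using (⊥-elim)
open import Relation.Nullary using (¬_; Dec; yes; no)
import Relation.Binary.PropositionalEquality as ≡
open import Function.Bundles using (_⇔_; mk⇔)
open import Defs

-- Integer coefficients are needed because the
-- identities below involve both subtraction and numerals such as 2 · 2 = 4.
module IntegerCoefficients {c ℓ : Level} (R : CommutativeRing c ℓ) where
  open CommutativeRing R
  open import Relation.Binary.Reasoning.Setoid setoid
  open import Algebra.Properties.Ring ring
    using (-‿involutive; -0#≈0#; -‿distribˡ-*; -‿distribʳ-*; -‿+-comm)
  open import Algebra.Solver.Ring.AlmostCommutativeRing
    using (fromCommutativeRing; _-Raw-AlmostCommutative⟶_)

  ι : ℕ → Carrier
  ι = natR R

  ι-+ : ∀ m n → ι (m ℕ.+ n) ≈ ι m + ι n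
  ι-+ zero n = sym (+-identityˡ _)
  ι-+ (suc m) n = trans (+-congˡ (ι-+ m n)) (sym (+-assoc _ _ _))

  ι-* : ∀ m n → ι (m ℕ.* n) ≈ ι m * ι n
  ι-* zero n = sym (zeroˡ _)
  ι-* (suc m) n = begin
    ι (n ℕ.+ m ℕ.* n)         ≈⟨ ι-+ n (m ℕ.* n) ⟩
    ι n + ι (m ℕ.* n)         ≈⟨ +-cong (sym (*-identityˡ _)) (ι-* m n) ⟩
    1# * ι n + ι m * ι n      ≈⟨ sym (distribʳ _ _ _) ⟩
    (1# + ι m) * ι n          ∎

  ι-^ : ∀ m e → ι (m ℕ.^ e) ≈ pow R (ι m) e
  ι-^ m zero = +-identityʳ 1#
  ι-^ m (suc e) = trans (ι-* m (m ℕ.^ e)) (*-congˡ (ι-^ m e))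

  ιℤ : ℤ → Carrier
  ιℤ (+ n) = ι n
  ιℤ -[1+ n ] = - ι (suc n)

  private
    cancel-1 : ∀ a b → (1# + a) - (1# + b) ≈ a - b
    cancel-1 a b = begin
      (1# + a) + - (1# + b)      ≈⟨ +-congˡ (sym (-‿+-comm 1# b)) ⟩
      (1# + a) + (- 1# + - b)    ≈⟨ +-assoc _ _ _ ⟩
      1# + (a + (- 1# + - b))    ≈⟨ +-congˡ (sym (+-assoc _ _ _)) ⟩
      1# + ((a + - 1#) + - b)    ≈⟨ +-congˡ (+-congʳ (+-comm _ _)) ⟩
      1# + ((- 1# + a) + - b)    ≈⟨ +-congˡ (+-assoc _ _ _) ⟩
      1# + (- 1# + (a + - b))    ≈⟨ sym (+-assoc _ _ _) ⟩
      (1# + - 1#) + (a + - b)    ≈⟨ +-congʳ (-‿inverseʳ 1#) ⟩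
      0# + (a + - b)             ≈⟨ +-identityˡ _ ⟩
      a - b                      ∎

    ιℤ-⊖ : ∀ m n → ιℤ (m ⊖ n) ≈ ι m - ι n
    ιℤ-⊖ m zero = begin
      ιℤ (m ⊖ 0)  ≡⟨ ≡.cong ιℤ (ℤP.⊖-≥ {m} {0} ℕ.z≤n) ⟩
      ι m         ≈⟨ sym (+-identityʳ _) ⟩
      ι m + 0#    ≈⟨ +-congˡ (sym -0#≈0#) ⟩
      ι m - 0#    ∎
    ιℤ-⊖ zero (suc n) = sym (+-identityˡ _)
    ιℤ-⊖ (suc m) (suc n) = begin
      ιℤ (suc m ⊖ suc n)       ≡⟨ ≡.cong ιℤ (ℤP.[1+m]⊖[1+n]≡m⊖n m n) ⟩
      ιℤ (m ⊖ n)               ≈⟨ ιℤ-⊖ m n ⟩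
      ι m - ι n                ≈⟨ sym (cancel-1 _ _) ⟩
      ι (suc m) - ι (suc n)    ∎

    ιℤ-+ : ∀ i j → ιℤ (i ℤ.+ j) ≈ ιℤ i + ιℤ j
    ιℤ-+ (+ m) (+ n) = ι-+ m n
    ιℤ-+ (+ m) -[1+ n ] = ιℤ-⊖ m (suc n)
    ιℤ-+ -[1+ m ] (+ n) = trans (ιℤ-⊖ n (suc m)) (+-comm _ _)
    ιℤ-+ -[1+ m ] -[1+ n ] = begin
      - ι (suc (suc (m ℕ.+ n)))   ≡⟨ ≡.cong (λ z → - ι (suc z)) (≡.sym (ℕP.+-suc m n)) ⟩
      - ι (suc m ℕ.+ suc n)       ≈⟨ -‿cong (ι-+ (suc m) (suc n)) ⟩
      - (ι (suc m) + ι (suc n))   ≈⟨ sym (-‿+-comm _ _) ⟩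
      - ι (suc m) + - ι (suc n)   ∎

    ιSign : Sign → Carrier
    ιSign Sign.+ = 1#
    ιSign Sign.- = - 1#

    ιSign-* : ∀ s t → ιSign (s Sign.* t) ≈ ιSign s * ιSign t
    ιSign-* Sign.+ Sign.+ = sym (*-identityˡ _)
    ιSign-* Sign.+ Sign.- = sym (*-identityˡ _)
    ιSign-* Sign.- Sign.+ = sym (*-identityʳ _)
    ιSign-* Sign.- Sign.- = begin
      1#                  ≈⟨ sym (-‿involutive 1#) ⟩
      - - 1#              ≈⟨ -‿cong (-‿cong (sym (*-identityˡ _))) ⟩
      - - (1# * 1#)       ≈⟨ -‿cong (-‿distribˡ-* _ _) ⟩
      - (- 1# * 1#)       ≈⟨ -‿distribʳ-* _ _ ⟩
      - 1# * - 1#         ∎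

    ιℤ-◃ : ∀ s n → ιℤ (s ◃ n) ≈ ιSign s * ι n
    ιℤ-◃ Sign.+ zero = sym (zeroʳ _)
    ιℤ-◃ Sign.- zero = sym (zeroʳ _)
    ιℤ-◃ Sign.+ (suc n) = sym (*-identityˡ _)
    ιℤ-◃ Sign.- (suc n) = trans (-‿cong (sym (*-identityˡ _))) (-‿distribˡ-* _ _)

    ιℤ-signAbs : ∀ i → ιℤ i ≈ ιSign (sign i) * ι ∣ i ∣
    ιℤ-signAbs (+ n) = sym (*-identityˡ _)
    ιℤ-signAbs -[1+ n ] = ιℤ-◃ Sign.- (suc n)

    interchange : ∀ a b c d → (a * b) * (c * d) ≈ (a * c) * (b * d)
    interchange a b c d = begin
      (a * b) * (c * d)   ≈⟨ *-assoc _ _ _ ⟩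
      a * (b * (c * d))   ≈⟨ *-congˡ (sym (*-assoc _ _ _)) ⟩
      a * ((b * c) * d)   ≈⟨ *-congˡ (*-congʳ (*-comm _ _)) ⟩
      a * ((c * b) * d)   ≈⟨ *-congˡ (*-assoc _ _ _) ⟩
      a * (c * (b * d))   ≈⟨ sym (*-assoc _ _ _) ⟩
      (a * c) * (b * d)   ∎

    ιℤ-* : ∀ i j → ιℤ (i ℤ.* j) ≈ ιℤ i * ιℤ j
    ιℤ-* i j = begin
      ιℤ (i ℤ.* j)
        ≈⟨ ιℤ-◃ (sign i Sign.* sign j) (∣ i ∣ ℕ.* ∣ j ∣) ⟩
      ιSign (sign i Sign.* sign j) * ι (∣ i ∣ ℕ.* ∣ j ∣)
        ≈⟨ *-cong (ιSign-* (sign i) (sign j)) (ι-* ∣ i ∣ ∣ j ∣) ⟩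
      (ιSign (sign i) * ιSign (sign j)) * (ι ∣ i ∣ * ι ∣ j ∣)
        ≈⟨ interchange _ _ _ _ ⟩
      (ιSign (sign i) * ι ∣ i ∣) * (ιSign (sign j) * ι ∣ j ∣)
        ≈⟨ *-cong (sym (ιℤ-signAbs i)) (sym (ιℤ-signAbs j)) ⟩
      ιℤ i * ιℤ j ∎

    ιℤ-neg : ∀ i → ιℤ (ℤ.- i) ≈ - ιℤ i
    ιℤ-neg (+ zero) = sym -0#≈0#
    ιℤ-neg (+ suc n) = refl
    ιℤ-neg -[1+ n ] = sym (-‿involutive _)

    ιℤ-homomorphism : ℤ.+-*-rawRing -Raw-AlmostCommutative⟶ fromCommutativeRing R
    ιℤ-homomorphism = record
      { ⟦_⟧ = ιℤ ; +-homo = ιℤ-+ ; *-homo = ιℤ-* ; -‿homo = ιℤ-neg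
      ; 0-homo = refl ; 1-homo = +-identityʳ 1# }

    ιℤ-dec : ∀ i j → Maybe (ιℤ i ≈ ιℤ j)
    ιℤ-dec i j with i ℤ.≟ j
    ... | yes ≡.refl = just refl
    ... | no _ = nothing

  open import Algebra.Solver.Ring ℤ.+-*-rawRing (fromCommutativeRing R) ιℤ-homomorphism ιℤ-dec public
    using (solve; _:=_; _:+_; _:*_; _:-_; con)

module FieldFacts {c ℓ : Level} (R : CommutativeRing c ℓ) (fld : IsFieldRing R) where
  open CommutativeRing R
  open import Relation.Binary.Reasoning.Setoid setoid

  inverse : ∀ a → ¬ (a ≈ 0#) → ∃ λ a⁻¹ → a⁻¹ * a ≈ 1#
  inverse a a≉0 with proj₂ fld a a≉0
  ... | (a⁻¹ , aa⁻¹≈1) = a⁻¹ , trans (*-comm _ _) aa⁻¹≈1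

  nonzero-* : ∀ a b → ¬ (a ≈ 0#) → ¬ (b ≈ 0#) → ¬ (a * b ≈ 0#)
  nonzero-* a b a≉0 b≉0 ab≈0 with inverse a a≉0
  ... | (a⁻¹ , a⁻¹a≈1) = b≉0 (begin
    b               ≈⟨ sym (*-identityˡ b) ⟩
    1# * b          ≈⟨ *-congʳ (sym a⁻¹a≈1) ⟩
    (a⁻¹ * a) * b   ≈⟨ *-assoc _ _ _ ⟩
    a⁻¹ * (a * b)   ≈⟨ *-congˡ ab≈0 ⟩
    a⁻¹ * 0#        ≈⟨ zeroʳ _ ⟩
    0#              ∎)

  nonzero-pow : ∀ a → ¬ (a ≈ 0#) → ∀ n → ¬ (pow R a n ≈ 0#)
  nonzero-pow a a≉0 zero 1≈0 = proj₁ fld (sym 1≈0)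
  nonzero-pow a a≉0 (suc n) = nonzero-* a _ a≉0 (nonzero-pow a a≉0 n)

-- A ring with q elements satisfies q · 1 = 0: translation by 1 permutes the
-- elements, so Σ_z z = Σ_z (z + 1) = Σ_z z + q · 1.  For a field of order p^e
-- this forces p · 1 = 0.  Finiteness also makes equality in R decidable.
module FiniteRing {c ℓ : Level} (R : CommutativeRing c ℓ) (q : ℕ) (card : HasCard R q) where
  open CommutativeRing R
  open import Relation.Binary.Reasoning.Setoid setoid
  open import Data.Fin as Fin using (Fin)
  open import Data.Fin.Permutation using (permutation)
  open import Function.Bundles using (Bijection)
  open import Algebra.Properties.CommutativeMonoid.Sum +-commutativeMonoid
    using (sum; sum-permute; sum-cong-≋; ∑-distrib-+; sum-replicate)
  open import Algebra.Properties.Monoid.Mult +-monoid using () renaming (_×_ to _·_)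
  open IntegerCoefficients R using (ι; ι-^)
  open Bijection card using (to; injective; strictlySurjective; cong)

  elem : Fin q → Carrier
  elem = to

  index : Carrier → Fin q
  index z = proj₁ (strictlySurjective z)

  elem-index : ∀ z → elem (index z) ≈ z
  elem-index z = proj₂ (strictlySurjective z)

  _≟_ : ∀ x y → Dec (x ≈ y)
  x ≟ y with index x Fin.≟ index y
  ... | yes i≡j = yes (trans (sym (elem-index x)) (trans (cong i≡j) (elem-index y)))
  ... | no i≢j = no λ x≈y → i≢j (injective (trans (elem-index x) (trans x≈y (sym (elem-index y)))))

  shift⁺ shift⁻ : Fin q → Fin q
  shift⁺ i = index (elem i + 1#)
  shift⁻ i = index (elem i - 1#)

  shift⁺∘shift⁻ : ∀ i → shift⁺ (shift⁻ i) ≡.≡ i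
  shift⁺∘shift⁻ i = injective (begin
    elem (shift⁺ (shift⁻ i))   ≈⟨ elem-index _ ⟩
    elem (shift⁻ i) + 1#       ≈⟨ +-congʳ (elem-index _) ⟩
    (elem i - 1#) + 1#         ≈⟨ +-assoc _ _ _ ⟩
    elem i + (- 1# + 1#)       ≈⟨ +-congˡ (-‿inverseˡ 1#) ⟩
    elem i + 0#                ≈⟨ +-identityʳ _ ⟩
    elem i                     ∎)

  shift⁻∘shift⁺ : ∀ i → shift⁻ (shift⁺ i) ≡.≡ i
  shift⁻∘shift⁺ i = injective (begin
    elem (shift⁻ (shift⁺ i))   ≈⟨ elem-index _ ⟩
    elem (shift⁺ i) - 1#       ≈⟨ +-congʳ (elem-index _) ⟩
    (elem i + 1#) - 1#         ≈⟨ +-assoc _ _ _ ⟩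
    elem i + (1# - 1#)         ≈⟨ +-congˡ (-‿inverseʳ 1#) ⟩
    elem i + 0#                ≈⟨ +-identityʳ _ ⟩
    elem i                     ∎)

  absorbs⇒zero : ∀ a b → a ≈ a + b → b ≈ 0#
  absorbs⇒zero a b a≈a+b = begin
    b              ≈⟨ sym (+-identityˡ b) ⟩
    0# + b         ≈⟨ +-congʳ (sym (-‿inverseˡ a)) ⟩
    (- a + a) + b  ≈⟨ +-assoc _ _ _ ⟩
    - a + (a + b)  ≈⟨ +-congˡ (sym a≈a+b) ⟩
    - a + a        ≈⟨ -‿inverseˡ a ⟩
    0#             ∎

  ι≈·1 : ∀ n → ι n ≈ n · 1#
  ι≈·1 zero = refl
  ι≈·1 (suc n) = +-congˡ (ι≈·1 n)

  card-annihilates : ι q ≈ 0#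
  card-annihilates = trans (ι≈·1 q) (absorbs⇒zero (sum elem) (q · 1#) (begin
    sum elem                       ≈⟨ sum-permute elem (permutation shift⁺ shift⁻ shift⁺∘shift⁻ shift⁻∘shift⁺) ⟩
    sum (λ i → elem (shift⁺ i))    ≈⟨ sum-cong-≋ (λ i → elem-index (elem i + 1#)) ⟩
    sum (λ i → elem i + 1#)        ≈⟨ ∑-distrib-+ elem (λ _ → 1#) ⟩
    sum elem + sum {q} (λ _ → 1#)  ≈⟨ +-congˡ (sum-replicate q) ⟩
    sum elem + q · 1#              ∎))

  -- in a field of order p^e the element p · 1 vanishes (its e-th power does)
  char-of-order : IsFieldRing R → ∀ p e → q ≡.≡ p ℕ.^ e → ι p ≈ 0#
  char-of-order fld p e ≡.refl with ι p ≟ 0#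
  ... | yes ιp≈0 = ιp≈0
  ... | no ιp≉0 = ⊥-elim (FieldFacts.nonzero-pow R fld (ι p) ιp≉0 e (trans (sym (ι-^ p e)) card-annihilates))

module PrimeBinomials where
  open import Data.Nat using (_!; _∸_; _<_; _≤_; s≤s; z≤n)
  open import Data.Nat.Divisibility using (_∣_; divides; ∣⇒≤; ∣1⇒≡1)
  open import Data.Nat.DivMod using (m/n*n≡m)
  open import Data.Nat.Primality using (euclidsLemma; prime⇒nonZero)
  open import Data.Nat.Combinatorics using (_C_; nCk≡n!/k![n-k]!; k![n∸k]!∣n!)

  prime≥2 : ∀ {p} → Prime p → 2 ≤ p
  prime≥2 {suc (suc _)} _ = s≤s (s≤s z≤n)

  prime∣! : ∀ {p} → Prime p → p ∣ p !
  prime∣! {suc m} _ = divides (m !) (ℕP.*-comm (suc m) (m !))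

  module _ {p : ℕ} (pr : Prime p) where
    private instance _ = prime⇒nonZero pr

    -- j! is a product of factors smaller than p
    prime∤! : ∀ j → j < p → ¬ (p ∣ j !)
    prime∤! zero _ p∣1 with ∣1⇒≡1 p∣1 | prime≥2 pr
    ... | ≡.refl | s≤s ()
    prime∤! (suc j) j<p p∣j! with euclidsLemma (suc j) (j !) pr p∣j!
    ... | inj₁ p∣1+j = ℕP.<⇒≱ j<p (∣⇒≤ p∣1+j)
    ... | inj₂ p∣j! = prime∤! j (ℕP.<-trans (ℕP.n<1+n j) j<p) p∣j!

    -- C(p,j) · j! (p-j)! = p!, and p divides neither j! nor (p-j)!
    prime∣C : ∀ j → 0 < j → j < p → p ∣ (p C j)
    prime∣C j 0<j j<p
      with euclidsLemma (p C j) (j ! ℕ.* (p ∸ j) !) pr (≡.subst (p ∣_) (≡.sym C·fact≡!) (prime∣! pr))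
      where
      instance _ = j ℕP.!* (p ∸ j) !≢0
      C·fact≡! : (p C j) ℕ.* (j ! ℕ.* (p ∸ j) !) ≡.≡ p !
      C·fact≡! = ≡.trans (≡.cong (ℕ._* (j ! ℕ.* (p ∸ j) !)) (nCk≡n!/k![n-k]! (ℕP.<⇒≤ j<p)))
                         (m/n*n≡m (k![n∸k]!∣n! (ℕP.<⇒≤ j<p)))
    ... | inj₁ p∣C = p∣C
    ... | inj₂ p∣fact with euclidsLemma (j !) ((p ∸ j) !) pr p∣fact
    ... | inj₁ p∣j! = ⊥-elim (prime∤! j j<p p∣j!)
    ... | inj₂ p∣[p-j]! = ⊥-elim (prime∤! (p ∸ j) (ℕP.∸-monoʳ-< 0<j (ℕP.<⇒≤ j<p)) p∣[p-j]!)

-- The Frobenius identity (x + y)^p = x^p + y^p in a commutative semiring in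
-- which p · z = 0 for every z: all middle binomial terms are multiples of p.
module Frobenius {a ℓ : Level} (S : CommutativeSemiring a ℓ) where
  open CommutativeSemiring S
  open import Relation.Binary.Reasoning.Setoid setoid
  open import Data.Nat using (_∸_; _<_; s≤s; z≤n)
  open import Data.Nat.Divisibility using (divides)
  open import Data.Nat.Combinatorics using (_C_; nCn≡1)
  open import Data.Fin as Fin using (Fin; toℕ; inject₁; fromℕ)
  import Data.Fin.Properties as FinP
  open import Algebra.Properties.Semiring.Exp semiring using (_^_)
  open import Algebra.Properties.CommutativeSemiring.Binomial S
    using (theorem; binomialExpansion; binomialTerm)
  open import Algebra.Properties.Monoid.Mult +-monoid using (×-assocˡ; ×-congʳ) renaming (_×_ to _·_)
  open import Algebra.Properties.Monoid.Sum +-monoid using (sum; sum-init-last; sum-cong-≋; sum-replicate-zero)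
  open PrimeBinomials using (prime∣C)

  ·-zero : ∀ n → n · 0# ≈ 0#
  ·-zero zero = refl
  ·-zero (suc n) = trans (+-identityˡ _) (·-zero n)

  frobenius : ∀ p → Prime p → (∀ z → p · z ≈ 0#) → ∀ x y → (x + y) ^ p ≈ x ^ p + y ^ p
  frobenius (suc m) pr char-p x y = begin
    (x + y) ^ suc m                                   ≈⟨ theorem (suc m) x y ⟩
    T Fin.zero + sum (λ j → T (Fin.suc j))            ≈⟨ +-congˡ (sum-init-last (λ j → T (Fin.suc j))) ⟩
    T Fin.zero + (sum (λ j → T (Fin.suc (inject₁ j))) + T (Fin.suc (fromℕ m)))
                                                      ≈⟨ +-cong first-term (+-cong middle-terms last-term) ⟩
    y ^ suc m + (0# + x ^ suc m)                      ≈⟨ +-congˡ (+-identityˡ _) ⟩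
    y ^ suc m + x ^ suc m                             ≈⟨ +-comm _ _ ⟩
    x ^ suc m + y ^ suc m                             ∎
    where
    T = binomialTerm x y (suc m)

    first-term : T Fin.zero ≈ y ^ suc m
    first-term = trans (+-identityʳ _) (*-identityˡ _)

    last-term : T (Fin.suc (fromℕ m)) ≈ x ^ suc m
    last-term = begin
      T (Fin.suc (fromℕ m))
        ≡⟨ ≡.cong (λ j → (suc m C j) · (x ^ j * y ^ (suc m ∸ j))) (≡.cong suc (FinP.toℕ-fromℕ m)) ⟩
      (suc m C suc m) · (x ^ suc m * y ^ (m ∸ m))
        ≡⟨ ≡.cong₂ (λ C j → C · (x ^ suc m * y ^ j)) (nCn≡1 (suc m)) (ℕP.n∸n≡0 m) ⟩
      1 · (x ^ suc m * 1#)  ≈⟨ +-identityʳ _ ⟩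
      x ^ suc m * 1#        ≈⟨ *-identityʳ _ ⟩
      x ^ suc m             ∎

    middle-term : ∀ (j : Fin m) → T (Fin.suc (inject₁ j)) ≈ 0#
    middle-term j with prime∣C pr (suc (toℕ (inject₁ j))) (s≤s z≤n)
                                  (s≤s (≡.subst (_< m) (≡.sym (FinP.toℕ-inject₁ j)) (FinP.toℕ<n j)))
    ... | divides r C≡r·p = begin
      (suc m C suc (toℕ (inject₁ j))) · B  ≡⟨ ≡.cong (_· B) C≡r·p ⟩
      (r ℕ.* suc m) · B                     ≈⟨ sym (×-assocˡ B r (suc m)) ⟩
      r · (suc m · B)                       ≈⟨ ×-congʳ r (char-p B) ⟩
      r · 0#                                ≈⟨ ·-zero r ⟩
      0#                                    ∎
      where B = x ^ suc (toℕ (inject₁ j)) * y ^ (m ∸ toℕ (inject₁ j))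

    middle-terms : sum (λ j → T (Fin.suc (inject₁ j))) ≈ 0#
    middle-terms = trans (sum-cong-≋ middle-term) (sum-replicate-zero m)

-- The ring Q = R[s]/(s² - t) for a fixed t ∈ R, with elements a + b s written as
-- pairs (a , b), as a commutative semiring (the structure needed for powers and
-- the binomial theorem).
module QuadraticExtension {c ℓ : Level} (R : CommutativeRing c ℓ) (t : CommutativeRing.Carrier R) where
  open CommutativeRing R
  open IntegerCoefficients R using (ι; solve; _:=_; _:+_; _:*_; con)

  Q : Set c
  Q = Carrier × Carrier

  infix 4 _≈Q_
  infixl 6 _+Q_
  infixl 7 _*Q_

  _≈Q_ : Q → Q → Set ℓ
  x ≈Q y = (proj₁ x ≈ proj₁ y) × (proj₂ x ≈ proj₂ y)

  _+Q_ : Q → Q → Q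
  x +Q y = (proj₁ x + proj₁ y , proj₂ x + proj₂ y)

  -- (a + b s)(c + d s) = (ac + t bd) + (ad + bc) s
  _*Q_ : Q → Q → Q
  x *Q y = ( proj₁ x * proj₁ y + t * (proj₂ x * proj₂ y)
           , proj₁ x * proj₂ y + proj₂ x * proj₁ y )

  0Q 1Q : Q
  0Q = (0# , 0#)
  1Q = (ι 1 , 0#)

  s : Q
  s = (0# , ι 1)

  private
    *-assoc₁ : ∀ a b c d e f t → (a * c + t * (b * d)) * e + t * ((a * d + b * c) * f) ≈ a * (c * e + t * (d * f)) + t * (b * (c * f + d * e))
    *-assoc₁ = solve 7 (λ a b c d e f t → ((a :* c :+ t :* (b :* d)) :* e :+ t :* ((a :* d :+ b :* c) :* f)) := (a :* (c :* e :+ t :* (d :* f)) :+ t :* (b :* (c :* f :+ d :* e)))) refl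
    *-assoc₂ : ∀ a b c d e f t → (a * c + t * (b * d)) * f + (a * d + b * c) * e ≈ a * (c * f + d * e) + b * (c * e + t * (d * f))
    *-assoc₂ = solve 7 (λ a b c d e f t → ((a :* c :+ t :* (b :* d)) :* f :+ (a :* d :+ b :* c) :* e) := (a :* (c :* f :+ d :* e) :+ b :* (c :* e :+ t :* (d :* f)))) refl
    *-identityˡ₁ : ∀ a b t → ι 1 * a + t * (0# * b) ≈ a
    *-identityˡ₁ = solve 3 (λ a b t → (con (+ 1) :* a :+ t :* (con (+ 0) :* b)) := a) refl
    *-identityˡ₂ : ∀ a b → ι 1 * b + 0# * a ≈ b
    *-identityˡ₂ = solve 2 (λ a b → (con (+ 1) :* b :+ con (+ 0) :* a) := b) refl
    *-identityʳ₁ : ∀ a b t → a * ι 1 + t * (b * 0#) ≈ a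
    *-identityʳ₁ = solve 3 (λ a b t → (a :* con (+ 1) :+ t :* (b :* con (+ 0))) := a) refl
    *-identityʳ₂ : ∀ a b → a * 0# + b * ι 1 ≈ b
    *-identityʳ₂ = solve 2 (λ a b → (a :* con (+ 0) :+ b :* con (+ 1)) := b) refl
    distribˡ₁ : ∀ a b c d e f t → a * (c + e) + t * (b * (d + f)) ≈ (a * c + t * (b * d)) + (a * e + t * (b * f))
    distribˡ₁ = solve 7 (λ a b c d e f t → (a :* (c :+ e) :+ t :* (b :* (d :+ f))) := ((a :* c :+ t :* (b :* d)) :+ (a :* e :+ t :* (b :* f)))) refl
    distribˡ₂ : ∀ a b c d e f → a * (d + f) + b * (c + e) ≈ (a * d + b * c) + (a * f + b * e)
    distribˡ₂ = solve 6 (λ a b c d e f → (a :* (d :+ f) :+ b :* (c :+ e)) := ((a :* d :+ b :* c) :+ (a :* f :+ b :* e))) refl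
    distribʳ₁ : ∀ a b c d e f t → (c + e) * a + t * ((d + f) * b) ≈ (c * a + t * (d * b)) + (e * a + t * (f * b))
    distribʳ₁ = solve 7 (λ a b c d e f t → ((c :+ e) :* a :+ t :* ((d :+ f) :* b)) := ((c :* a :+ t :* (d :* b)) :+ (e :* a :+ t :* (f :* b)))) refl
    distribʳ₂ : ∀ a b c d e f → (c + e) * b + (d + f) * a ≈ (c * b + d * a) + (e * b + f * a)
    distribʳ₂ = solve 6 (λ a b c d e f → ((c :+ e) :* b :+ (d :+ f) :* a) := ((c :* b :+ d :* a) :+ (e :* b :+ f :* a))) refl
    zeroˡ₁ : ∀ a b t → 0# * a + t * (0# * b) ≈ 0#
    zeroˡ₁ = solve 3 (λ a b t → (con (+ 0) :* a :+ t :* (con (+ 0) :* b)) := con (+ 0)) refl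
    zeroˡ₂ : ∀ a b → 0# * b + 0# * a ≈ 0#
    zeroˡ₂ = solve 2 (λ a b → (con (+ 0) :* b :+ con (+ 0) :* a) := con (+ 0)) refl
    zeroʳ₁ : ∀ a b t → a * 0# + t * (b * 0#) ≈ 0#
    zeroʳ₁ = solve 3 (λ a b t → (a :* con (+ 0) :+ t :* (b :* con (+ 0))) := con (+ 0)) refl
    zeroʳ₂ : ∀ a b → a * 0# + b * 0# ≈ 0#
    zeroʳ₂ = solve 2 (λ a b → (a :* con (+ 0) :+ b :* con (+ 0)) := con (+ 0)) refl
    *-comm₁ : ∀ a b c d t → a * c + t * (b * d) ≈ c * a + t * (d * b)
    *-comm₁ = solve 5 (λ a b c d t → (a :* c :+ t :* (b :* d)) := (c :* a :+ t :* (d :* b))) refl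
    *-comm₂ : ∀ a b c d → a * d + b * c ≈ c * b + d * a
    *-comm₂ = solve 4 (λ a b c d → (a :* d :+ b :* c) := (c :* b :+ d :* a)) refl

  Q-commutativeSemiring : CommutativeSemiring c ℓ
  Q-commutativeSemiring = record
    { Carrier = Q ; _≈_ = _≈Q_ ; _+_ = _+Q_ ; _*_ = _*Q_ ; 0# = 0Q ; 1# = 1Q
    ; isCommutativeSemiring = record
      { isSemiring = record
        { isSemiringWithoutAnnihilatingZero = record
          { +-isCommutativeMonoid = record
            { isMonoid = record
              { isSemigroup = record
                { isMagma = record
                  { isEquivalence = record
                    { refl = refl , refl
                    ; sym = λ (e , f) → sym e , sym f
                    ; trans = λ (e , f) (g , h) → trans e g , trans f h }
                  ; ∙-cong = λ (e , f) (g , h) → +-cong e g , +-cong f h }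
                ; assoc = λ _ _ _ → +-assoc _ _ _ , +-assoc _ _ _ }
              ; identity = (λ _ → +-identityˡ _ , +-identityˡ _) , (λ _ → +-identityʳ _ , +-identityʳ _) }
            ; comm = λ _ _ → +-comm _ _ , +-comm _ _ }
          ; *-cong = λ (e , f) (g , h) → +-cong (*-cong e g) (*-congˡ (*-cong f h)) , +-cong (*-cong e h) (*-cong f g)
          ; *-assoc = λ _ _ _ → *-assoc₁ _ _ _ _ _ _ t , *-assoc₂ _ _ _ _ _ _ t
          ; *-identity = (λ _ → *-identityˡ₁ _ _ t , *-identityˡ₂ _ _) , (λ _ → *-identityʳ₁ _ _ t , *-identityʳ₂ _ _)
          ; distrib = (λ _ _ _ → distribˡ₁ _ _ _ _ _ _ t , distribˡ₂ _ _ _ _ _ _)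
                    , (λ _ _ _ → distribʳ₁ _ _ _ _ _ _ t , distribʳ₂ _ _ _ _ _ _) }
        ; zero = (λ _ → zeroˡ₁ _ _ t , zeroˡ₂ _ _) , (λ _ → zeroʳ₁ _ _ t , zeroʳ₂ _ _) }
      ; *-comm = λ _ _ → *-comm₁ _ _ _ _ t , *-comm₂ _ _ _ _ } }

-- For x ∈ R let t = 1 - 4x, Q = R[s]/(s² - t) and w = 1 + s, a root of
-- z² - 2z + 4x.  Writing w^n = A_n + B_n s, the sequence 2^n D_{n,k}(x) satisfies
-- the same recurrence u_{n+2} = 2 u_{n+1} - 4x u_n as (2-k) A_n + k B_n, hence
--     2^n D_{n,k}(x) = (2 - k) A_n + k B_n            (Binet formula).
module Discriminant {c ℓ : Level} (R : CommutativeRing c ℓ) (x : CommutativeRing.Carrier R) where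
  open CommutativeRing R
  open import Relation.Binary.Reasoning.Setoid setoid
  open IntegerCoefficients R using (ι; solve; _:=_; _:+_; _:*_; _:-_; con)

  t : Carrier
  t = ι 1 - ι 4 * x

  open QuadraticExtension R t public
  open import Algebra.Properties.Semiring.Exp (CommutativeSemiring.semiring Q-commutativeSemiring)
    public using (_^_)

  w : Q
  w = 1Q +Q s

  private
    base₀ : ∀ K → ι 1 * (ι 2 - K) ≈ (ι 2 - K) * ι 1 + K * 0#
    base₀ = solve 1 (λ K → (con (+ 1) :* (con (+ 2) :- K)) := ((con (+ 2) :- K) :* con (+ 1) :+ K :* con (+ 0))) refl
    base₁ : ∀ K t → (ι 2 * ι 1) * ι 1 ≈ (ι 2 - K) * ((ι 1 + 0#) * ι 1 + t * ((0# + ι 1) * 0#)) + K * ((ι 1 + 0#) * 0# + (0# + ι 1) * ι 1)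
    base₁ = solve 2 (λ K t → ((con (+ 2) :* con (+ 1)) :* con (+ 1)) := ((con (+ 2) :- K) :* ((con (+ 1) :+ con (+ 0)) :* con (+ 1) :+ t :* ((con (+ 0) :+ con (+ 1)) :* con (+ 0))) :+ K :* ((con (+ 1) :+ con (+ 0)) :* con (+ 0) :+ (con (+ 0) :+ con (+ 1)) :* con (+ 1)))) refl
    step-D : ∀ u d₁ d₀ x → (ι 2 * (ι 2 * u)) * (d₁ - x * d₀) ≈ ι 2 * ((ι 2 * u) * d₁) - ι 4 * x * (u * d₀)
    step-D = solve 4 (λ u d₁ d₀ x → ((con (+ 2) :* (con (+ 2) :* u)) :* (d₁ :- x :* d₀)) := (con (+ 2) :* ((con (+ 2) :* u) :* d₁) :- con (+ 4) :* x :* (u :* d₀))) refl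
    -- the same recurrence for (2-k) A_n + k B_n, from w² = 2w - 4x
    step-AB : ∀ K x a b →
      let t = ι 1 - ι 4 * x
          a₁ = (ι 1 + 0#) * a + t * ((0# + ι 1) * b)
          b₁ = (ι 1 + 0#) * b + (0# + ι 1) * a
          a₂ = (ι 1 + 0#) * a₁ + t * ((0# + ι 1) * b₁)
          b₂ = (ι 1 + 0#) * b₁ + (0# + ι 1) * a₁ in
      ι 2 * ((ι 2 - K) * a₁ + K * b₁) - ι 4 * x * ((ι 2 - K) * a + K * b) ≈ (ι 2 - K) * a₂ + K * b₂
    step-AB = solve 4 (λ K x a b →
      let t = con (+ 1) :- con (+ 4) :* x
          a₁ = (con (+ 1) :+ con (+ 0)) :* a :+ t :* ((con (+ 0) :+ con (+ 1)) :* b)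
          b₁ = (con (+ 1) :+ con (+ 0)) :* b :+ (con (+ 0) :+ con (+ 1)) :* a
          a₂ = (con (+ 1) :+ con (+ 0)) :* a₁ :+ t :* ((con (+ 0) :+ con (+ 1)) :* b₁)
          b₂ = (con (+ 1) :+ con (+ 0)) :* b₁ :+ (con (+ 0) :+ con (+ 1)) :* a₁ in
      (con (+ 2) :* ((con (+ 2) :- K) :* a₁ :+ K :* b₁) :- con (+ 4) :* x :* ((con (+ 2) :- K) :* a :+ K :* b)) := ((con (+ 2) :- K) :* a₂ :+ K :* b₂)) refl

  module _ (k : ℕ) where
    binetSide : ℕ → Carrier
    binetSide n = (ι 2 - ι k) * proj₁ (w ^ n) + ι k * proj₂ (w ^ n)

    BinetAt : ℕ → Set ℓ
    BinetAt n = pow R (ι 2) n * D R n k x ≈ binetSide n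

    binet-pair : ∀ n → BinetAt n × BinetAt (suc n)
    binet-pair zero = trans (*-congʳ one≈ι1) (base₀ (ι k)) , trans (*-cong (*-congˡ one≈ι1) one≈ι1) (base₁ (ι k) t)
      where one≈ι1 = sym (+-identityʳ 1#)
    binet-pair (suc n) with binet-pair n
    ... | (binet-n , binet-1+n) = binet-1+n , (begin
      (ι 2 * (ι 2 * pow R (ι 2) n)) * (D R (suc n) k x - x * D R n k x)
        ≈⟨ step-D _ _ _ _ ⟩
      ι 2 * ((ι 2 * pow R (ι 2) n) * D R (suc n) k x) - ι 4 * x * (pow R (ι 2) n * D R n k x)
        ≈⟨ +-cong (*-congˡ binet-1+n) (-‿cong (*-congˡ binet-n)) ⟩
      ι 2 * binetSide (suc n) - ι 4 * x * binetSide n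
        ≈⟨ step-AB (ι k) x (proj₁ (w ^ n)) (proj₂ (w ^ n)) ⟩
      binetSide (suc (suc n)) ∎)

    binet : ∀ n → pow R (ι 2) n * D R n k x ≈ binetSide n
    binet n = proj₁ (binet-pair n)

module OddNumbers where
  open import Data.Nat using (_/_)
  open import Data.Nat.DivMod using (m*n/n≡m)
  open import Data.Nat.Divisibility using (divides)
  open import Data.Nat.Primality using (prime⇒irreducible)
  open import Data.Nat.Tactic.RingSolver using (solve-∀)
  open ≡.≡-Reasoning

  Even Odd : ℕ → Set
  Even n = ∃ λ δ → n ≡.≡ 2 ℕ.* δ
  Odd n = ∃ λ δ → n ≡.≡ suc (2 ℕ.* δ)

  parity : ∀ n → Even n ⊎ Odd n
  parity zero = inj₁ (0 , ≡.refl)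
  parity (suc n) with parity n
  ... | inj₁ (δ , n≡2δ) = inj₂ (δ , ≡.cong suc n≡2δ)
  ... | inj₂ (δ , n≡1+2δ) = inj₁ (suc δ , ≡.trans (≡.cong suc n≡1+2δ) (≡.sym (ℕP.*-suc 2 δ)))

  -- an even prime is 2
  odd-prime : ∀ p → Prime p → ¬ (p ≡.≡ 2) → Odd p
  odd-prime p pr p≢2 with parity p
  ... | inj₂ p-odd = p-odd
  ... | inj₁ (δ , p≡2δ) with prime⇒irreducible pr (divides δ (≡.trans p≡2δ (ℕP.*-comm 2 δ)))
  ... | inj₁ ()
  ... | inj₂ 2≡p = ⊥-elim (p≢2 (≡.sym 2≡p))

  odd-* : ∀ m n → Odd m → Odd n → Odd (m ℕ.* n)
  odd-* _ _ (α , ≡.refl) (β , ≡.refl) = α ℕ.+ β ℕ.+ 2 ℕ.* (α ℕ.* β) , expand α β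
    where
    expand : ∀ α β → suc (2 ℕ.* α) ℕ.* suc (2 ℕ.* β) ≡.≡ suc (2 ℕ.* (α ℕ.+ β ℕ.+ 2 ℕ.* (α ℕ.* β)))
    expand = solve-∀

  odd-^ : ∀ p → Odd p → ∀ l → Odd (p ℕ.^ l)
  odd-^ p p-odd zero = 0 , ≡.refl
  odd-^ p p-odd (suc l) = odd-* p (p ℕ.^ l) p-odd (odd-^ p p-odd l)

  half-double : ∀ m → 2 ℕ.* m / 2 ≡.≡ m
  half-double m = ≡.trans (≡.cong (_/ 2) (ℕP.*-comm 2 m)) (m*n/n≡m m 2)

  half-pred : ∀ {a} α → a ≡.≡ suc (2 ℕ.* α) → (a ℕ.∸ 1) / 2 ≡.≡ α
  half-pred α ≡.refl = half-double α

  half-sum : ∀ {a b} α β → a ≡.≡ suc (2 ℕ.* α) → b ≡.≡ suc (2 ℕ.* β) →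
    (a ℕ.+ b) / 2 ≡.≡ suc (α ℕ.+ β)
  half-sum α β ≡.refl ≡.refl = begin
    (suc (2 ℕ.* α) ℕ.+ suc (2 ℕ.* β)) / 2  ≡⟨ ≡.cong (_/ 2) (sum-double α β) ⟩
    2 ℕ.* suc (α ℕ.+ β) / 2                ≡⟨ half-double (suc (α ℕ.+ β)) ⟩
    suc (α ℕ.+ β)                          ∎
    where
    sum-double : ∀ α β → suc (2 ℕ.* α) ℕ.+ suc (2 ℕ.* β) ≡.≡ 2 ℕ.* suc (α ℕ.+ β)
    sum-double = solve-∀

  half-pred-sum : ∀ {a b c} α β γ → a ≡.≡ suc (2 ℕ.* α) → b ≡.≡ suc (2 ℕ.* β) → c ≡.≡ suc (2 ℕ.* γ) →
    (a ℕ.+ b ℕ.+ c ℕ.∸ 1) / 2 ≡.≡ suc (α ℕ.+ β) ℕ.+ γ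
  half-pred-sum α β γ ≡.refl ≡.refl ≡.refl = begin
    (suc (2 ℕ.* α) ℕ.+ suc (2 ℕ.* β) ℕ.+ suc (2 ℕ.* γ) ℕ.∸ 1) / 2  ≡⟨ ≡.cong (_/ 2) (sum-double α β γ) ⟩
    2 ℕ.* (suc (α ℕ.+ β) ℕ.+ γ) / 2                                ≡⟨ half-double _ ⟩
    suc (α ℕ.+ β) ℕ.+ γ                                            ∎
    where
    sum-double : ∀ α β γ → suc (2 ℕ.* α) ℕ.+ suc (2 ℕ.* β) ℕ.+ suc (2 ℕ.* γ) ℕ.∸ 1 ≡.≡ 2 ℕ.* (suc (α ℕ.+ β) ℕ.+ γ)
    sum-double α β γ = ≡.trans (≡.cong (ℕ._∸ 1) (ℕP.+-suc (suc (2 ℕ.* α) ℕ.+ suc (2 ℕ.* β)) (2 ℕ.* γ))) (twice α β γ)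
      where
      twice : ∀ α β γ → suc (2 ℕ.* α) ℕ.+ suc (2 ℕ.* β) ℕ.+ 2 ℕ.* γ ≡.≡ 2 ℕ.* (suc (α ℕ.+ β) ℕ.+ γ)
      twice = solve-∀

-- Powers of w = 1 + s in characteristic p: Frobenius gives w^{p^l} = 1 + s^{p^l},
-- and s^{2δ+1} = t^δ s, so w^{p^l} = 1 + t^δ s whenever p^l = 2δ + 1.
module PowersOfW {c ℓ : Level} (R : CommutativeRing c ℓ) (x : CommutativeRing.Carrier R)
                 (p : ℕ) (p-prime : Prime p)
                 (char-p : CommutativeRing._≈_ R (natR R p) (CommutativeRing.0# R)) where
  open CommutativeRing R
  open IntegerCoefficients R using (ι; solve; _:=_; _:+_; _:*_; con)
  open Discriminant R x
  open CommutativeSemiring Q-commutativeSemiring using ()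
    renaming (+-monoid to Q-+-monoid; setoid to Q-setoid; refl to Q-refl; sym to Q-sym; trans to Q-trans;
              *-congˡ to *Q-congˡ; *-identityˡ to *Q-identityˡ; *-identityʳ to *Q-identityʳ; +-cong to +Q-cong)
  open import Algebra.Properties.Semiring.Exp (CommutativeSemiring.semiring Q-commutativeSemiring)
    using (^-congˡ; ^-assocʳ)
  open import Algebra.Properties.Monoid.Mult +-monoid using () renaming (_×_ to _·_)
  open import Algebra.Properties.Monoid.Mult Q-+-monoid using () renaming (_×_ to _·Q_)
  import Relation.Binary.Reasoning.Setoid Q-setoid as Q-Reasoning
  open Frobenius Q-commutativeSemiring using (frobenius)

  ·≈ι* : ∀ n a → n · a ≈ ι n * a
  ·≈ι* zero a = sym (zeroˡ a)
  ·≈ι* (suc n) a = trans (+-cong (sym (*-identityˡ a)) (·≈ι* n a)) (sym (distribʳ _ _ _))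

  ·Q-componentwise : ∀ n z → n ·Q z ≈Q (n · proj₁ z , n · proj₂ z)
  ·Q-componentwise zero z = refl , refl
  ·Q-componentwise (suc n) z = +-congˡ (proj₁ (·Q-componentwise n z)) , +-congˡ (proj₂ (·Q-componentwise n z))

  Q-char-p : ∀ z → p ·Q z ≈Q 0Q
  Q-char-p z = vanishes (proj₁ (·Q-componentwise p z)) , vanishes (proj₂ (·Q-componentwise p z))
    where
    vanishes : ∀ {u a} → u ≈ p · a → u ≈ 0#
    vanishes {a = a} u≈p·a = trans u≈p·a (trans (·≈ι* p a) (trans (*-congʳ char-p) (zeroˡ a)))

  1Q^ : ∀ n → 1Q ^ n ≈Q 1Q
  1Q^ zero = refl , refl
  1Q^ (suc n) = Q-trans (*Q-congˡ (1Q^ n)) (*Q-identityˡ 1Q)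

  w^p^ : ∀ l → w ^ (p ℕ.^ l) ≈Q 1Q +Q s ^ (p ℕ.^ l)
  w^p^ zero = Q-trans (*Q-identityʳ w) (+Q-cong Q-refl (Q-sym (*Q-identityʳ s)))
  w^p^ (suc l) = Q-Reasoning.begin
    w ^ (p ℕ.* p ℕ.^ l)                 Q-Reasoning.≡⟨ ≡.cong (w ^_) (ℕP.*-comm p (p ℕ.^ l)) ⟩
    w ^ (p ℕ.^ l ℕ.* p)                 Q-Reasoning.≈⟨ Q-sym (^-assocʳ w (p ℕ.^ l) p) ⟩
    (w ^ (p ℕ.^ l)) ^ p                 Q-Reasoning.≈⟨ ^-congˡ p (w^p^ l) ⟩
    (1Q +Q s ^ (p ℕ.^ l)) ^ p           Q-Reasoning.≈⟨ frobenius p p-prime Q-char-p 1Q (s ^ (p ℕ.^ l)) ⟩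
    1Q ^ p +Q (s ^ (p ℕ.^ l)) ^ p       Q-Reasoning.≈⟨ +Q-cong (1Q^ p) (^-assocʳ s (p ℕ.^ l) p) ⟩
    1Q +Q s ^ (p ℕ.^ l ℕ.* p)           Q-Reasoning.≡⟨ ≡.cong (λ m → 1Q +Q s ^ m) (ℕP.*-comm (p ℕ.^ l) p) ⟩
    1Q +Q s ^ (p ℕ.* p ℕ.^ l)           Q-Reasoning.∎

  s²-scales : ∀ z → s *Q (s *Q z) ≈Q (t * proj₁ z , t * proj₂ z)
  s²-scales z = scale₁ (proj₁ z) (proj₂ z) t , scale₂ (proj₁ z) (proj₂ z) t
    where
    scale₁ : ∀ a b t → 0# * (0# * a + t * (ι 1 * b)) + t * (ι 1 * (0# * b + ι 1 * a)) ≈ t * a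
    scale₁ = solve 3 (λ a b t → (con (+ 0) :* (con (+ 0) :* a :+ t :* (con (+ 1) :* b)) :+ t :* (con (+ 1) :* (con (+ 0) :* b :+ con (+ 1) :* a))) := (t :* a)) refl
    scale₂ : ∀ a b t → 0# * (0# * b + ι 1 * a) + ι 1 * (0# * a + t * (ι 1 * b)) ≈ t * b
    scale₂ = solve 3 (λ a b t → (con (+ 0) :* (con (+ 0) :* b :+ con (+ 1) :* a) :+ con (+ 1) :* (con (+ 0) :* a :+ t :* (con (+ 1) :* b))) := (t :* b)) refl

  s^odd : ∀ δ → s ^ suc (2 ℕ.* δ) ≈Q (0# , pow R t δ)
  s^odd zero = Q-trans (*Q-identityʳ s) (refl , +-identityʳ 1#)
  s^odd (suc δ) = Q-Reasoning.begin
    s ^ suc (2 ℕ.* suc δ)             Q-Reasoning.≡⟨ ≡.cong (λ m → s ^ suc m) (ℕP.*-suc 2 δ) ⟩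
    s *Q (s *Q s ^ suc (2 ℕ.* δ))     Q-Reasoning.≈⟨ s²-scales _ ⟩
    (t * proj₁ (s ^ suc (2 ℕ.* δ)) , t * proj₂ (s ^ suc (2 ℕ.* δ)))
                                      Q-Reasoning.≈⟨ trans (*-congˡ (proj₁ (s^odd δ))) (zeroʳ t) , *-congˡ (proj₂ (s^odd δ)) ⟩
    (0# , t * pow R t δ)              Q-Reasoning.∎

  w^odd-p^ : ∀ l δ → p ℕ.^ l ≡.≡ suc (2 ℕ.* δ) → w ^ (p ℕ.^ l) ≈Q 1Q +Q (0# , pow R t δ)
  w^odd-p^ l δ p^l≡1+2δ = Q-trans (w^p^ l) (+Q-cong Q-refl (≡.subst (λ m → s ^ m ≈Q (0# , pow R t δ)) (≡.sym p^l≡1+2δ) (s^odd δ)))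

-- If a = 2α+1, b = 2β+1, c = 2γ+1 and w^a = 1 + t^α s, w^b = 1 + t^β s,
-- w^c = 1 + t^γ s, then expanding w^{a+b+c} = w^a w^b w^c in the Binet formula gives
--     2^{a+b+c} D_{a+b+c,k}(x) = (2 - k) + G(t),   t = 1 - 4x.
module ThreeTermIdentity {c ℓ : Level} (R : CommutativeRing c ℓ) (k : ℕ) (x : CommutativeRing.Carrier R) where
  open CommutativeRing R
  open import Relation.Binary.Reasoning.Setoid setoid
  open IntegerCoefficients R using (ι; solve; _:=_; _:+_; _:*_; _:-_; con)
  open Discriminant R x
  open CommutativeSemiring Q-commutativeSemiring using () renaming (trans to Q-trans; *-cong to *Q-cong)
  open import Algebra.Properties.Semiring.Exp (CommutativeSemiring.semiring Q-commutativeSemiring)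
    using (^-homo-*)
  open OddNumbers using (half-pred; half-sum; half-pred-sum)

  pow-+ : ∀ z m n → pow R z (m ℕ.+ n) ≈ pow R z m * pow R z n
  pow-+ z zero n = sym (*-identityˡ _)
  pow-+ z (suc m) n = trans (*-congˡ (pow-+ z m n)) (sym (*-assoc _ _ _))

  G-odd : ∀ {a b c} α β γ → a ≡.≡ suc (2 ℕ.* α) → b ≡.≡ suc (2 ℕ.* β) → c ≡.≡ suc (2 ℕ.* γ) →
    let u = pow R t α ; v = pow R t β ; y = pow R t γ in
    G R k a b c t ≈ ι k * (t * ((u * v) * y)) + (ι 2 - ι k) * (t * (u * v) + t * (u * y) + t * (v * y)) + ι k * (u + v + y)
  G-odd {a} {b} {c} α β γ a-odd b-odd c-odd =
    +-cong (+-cong (*-congˡ top) (*-congˡ (+-cong (+-cong (pair α β a-odd b-odd) (pair α γ a-odd c-odd)) (pair β γ b-odd c-odd))))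
           (*-congˡ (+-cong (+-cong (single α a-odd) (single β b-odd)) (single γ c-odd)))
    where
    single : ∀ {m} δ → m ≡.≡ suc (2 ℕ.* δ) → pow R t ((m ℕ.∸ 1) ℕ./ 2) ≈ pow R t δ
    single δ m-odd = reflexive (≡.cong (pow R t) (half-pred δ m-odd))
    pair : ∀ {m m′} δ δ′ → m ≡.≡ suc (2 ℕ.* δ) → m′ ≡.≡ suc (2 ℕ.* δ′) →
      pow R t ((m ℕ.+ m′) ℕ./ 2) ≈ t * (pow R t δ * pow R t δ′)
    pair δ δ′ m-odd m′-odd = trans (reflexive (≡.cong (pow R t) (half-sum δ δ′ m-odd m′-odd))) (*-congˡ (pow-+ t δ δ′))
    top : pow R t ((a ℕ.+ b ℕ.+ c ℕ.∸ 1) ℕ./ 2) ≈ t * ((pow R t α * pow R t β) * pow R t γ)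
    top = trans (reflexive (≡.cong (pow R t) (half-pred-sum α β γ a-odd b-odd c-odd)))
                (*-congˡ (trans (pow-+ t (α ℕ.+ β) γ) (*-congʳ (pow-+ t α β))))

  private
    -- (2-k) A + k B for (1 + u s)(1 + v s)(1 + y s) = A + B s
    expand : ∀ K t u v y →
      let ab₁ = (ι 1 + 0#) * (ι 1 + 0#) + t * ((0# + u) * (0# + v))
          ab₂ = (ι 1 + 0#) * (0# + v) + (0# + u) * (ι 1 + 0#) in
      (ι 2 - K) * (ab₁ * (ι 1 + 0#) + t * (ab₂ * (0# + y))) + K * (ab₁ * (0# + y) + ab₂ * (ι 1 + 0#))
      ≈ (ι 2 - K) + (K * (t * ((u * v) * y)) + (ι 2 - K) * (t * (u * v) + t * (u * y) + t * (v * y)) + K * (u + v + y))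
    expand = solve 5 (λ K t u v y →
      let one = con (+ 1) :+ con (+ 0)
          ab₁ = one :* one :+ t :* ((con (+ 0) :+ u) :* (con (+ 0) :+ v))
          ab₂ = one :* (con (+ 0) :+ v) :+ (con (+ 0) :+ u) :* one in
      ((con (+ 2) :- K) :* (ab₁ :* one :+ t :* (ab₂ :* (con (+ 0) :+ y))) :+ K :* (ab₁ :* (con (+ 0) :+ y) :+ ab₂ :* one))
      := ((con (+ 2) :- K) :+ (K :* (t :* ((u :* v) :* y)) :+ (con (+ 2) :- K) :* (t :* (u :* v) :+ t :* (u :* y) :+ t :* (v :* y)) :+ K :* (u :+ v :+ y)))) refl

  three-term-identity : ∀ {a b c} α β γ → a ≡.≡ suc (2 ℕ.* α) → b ≡.≡ suc (2 ℕ.* β) → c ≡.≡ suc (2 ℕ.* γ) →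
    w ^ a ≈Q 1Q +Q (0# , pow R t α) → w ^ b ≈Q 1Q +Q (0# , pow R t β) → w ^ c ≈Q 1Q +Q (0# , pow R t γ) →
    pow R (ι 2) (a ℕ.+ b ℕ.+ c) * D R (a ℕ.+ b ℕ.+ c) k x ≈ (ι 2 - ι k) + G R k a b c t
  three-term-identity {a} {b} {c} α β γ a-odd b-odd c-odd w^a w^b w^c = begin
    pow R (ι 2) (a ℕ.+ b ℕ.+ c) * D R (a ℕ.+ b ℕ.+ c) k x  ≈⟨ binet k (a ℕ.+ b ℕ.+ c) ⟩
    binetSide k (a ℕ.+ b ℕ.+ c)                          ≈⟨ +-cong (*-congˡ (proj₁ w^n)) (*-congˡ (proj₂ w^n)) ⟩
    _                                                    ≈⟨ expand (ι k) t (pow R t α) (pow R t β) (pow R t γ) ⟩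
    (ι 2 - ι k) + _                                      ≈⟨ +-congˡ (sym (G-odd α β γ a-odd b-odd c-odd)) ⟩
    (ι 2 - ι k) + G R k a b c t                          ∎
    where
    w^n : w ^ (a ℕ.+ b ℕ.+ c) ≈Q (1Q +Q (0# , pow R t α)) *Q (1Q +Q (0# , pow R t β)) *Q (1Q +Q (0# , pow R t γ))
    w^n = Q-trans (^-homo-* w (a ℕ.+ b) c) (*Q-cong (Q-trans (^-homo-* w a b) (*Q-cong w^a w^b)) w^c)

module Congruence {c ℓ : Level} (R : CommutativeRing c ℓ) where
  open CommutativeRing R

  Respects≈ : (Carrier → Carrier) → Set (c Level.⊔ ℓ)
  Respects≈ f = ∀ {a b} → a ≈ b → f a ≈ f b

  pow-cong : ∀ n → Respects≈ (λ z → pow R z n)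
  pow-cong zero a≈b = refl
  pow-cong (suc n) a≈b = *-cong a≈b (pow-cong n a≈b)

  G-cong : ∀ k a b c → Respects≈ (G R k a b c)
  G-cong k a b c y≈z =
    +-cong (+-cong (*-congˡ (pow-cong ((a ℕ.+ b ℕ.+ c ℕ.∸ 1) ℕ./ 2) y≈z))
                   (*-congˡ (+-cong (+-cong (pow-cong ((a ℕ.+ b) ℕ./ 2) y≈z) (pow-cong ((a ℕ.+ c) ℕ./ 2) y≈z))
                                    (pow-cong ((b ℕ.+ c) ℕ./ 2) y≈z))))
           (*-congˡ (+-cong (+-cong (pow-cong ((a ℕ.∸ 1) ℕ./ 2) y≈z) (pow-cong ((b ℕ.∸ 1) ℕ./ 2) y≈z))
                            (pow-cong ((c ℕ.∸ 1) ℕ./ 2) y≈z)))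

module PermutationTransfer {c ℓ : Level} (R : CommutativeRing c ℓ) where
  open CommutativeRing R
  open import Relation.Binary.Reasoning.Setoid setoid
  open Congruence R using (Respects≈)

  +-cancelˡ : ∀ a u v → a + u ≈ a + v → u ≈ v
  +-cancelˡ a u v a+u≈a+v = begin
    u              ≈⟨ sym (+-identityˡ u) ⟩
    0# + u         ≈⟨ +-congʳ (sym (-‿inverseˡ a)) ⟩
    (- a + a) + u  ≈⟨ +-assoc _ _ _ ⟩
    - a + (a + u)  ≈⟨ +-congˡ a+u≈a+v ⟩
    - a + (a + v)  ≈⟨ sym (+-assoc _ _ _) ⟩
    (- a + a) + v  ≈⟨ +-congʳ (-‿inverseˡ a) ⟩
    0# + v         ≈⟨ +-identityˡ v ⟩
    v              ∎

  *-cancelˡ : ∀ a a⁻¹ u v → a⁻¹ * a ≈ 1# → a * u ≈ a * v → u ≈ v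
  *-cancelˡ a a⁻¹ u v a⁻¹a≈1 au≈av = begin
    u                ≈⟨ sym (*-identityˡ u) ⟩
    1# * u           ≈⟨ *-congʳ (sym a⁻¹a≈1) ⟩
    (a⁻¹ * a) * u    ≈⟨ *-assoc _ _ _ ⟩
    a⁻¹ * (a * u)    ≈⟨ *-congˡ au≈av ⟩
    a⁻¹ * (a * v)    ≈⟨ sym (*-assoc _ _ _) ⟩
    (a⁻¹ * a) * v    ≈⟨ *-congʳ a⁻¹a≈1 ⟩
    1# * v           ≈⟨ *-identityˡ v ⟩
    v                ∎

  module _ (f g φ ψ : Carrier → Carrier) (κ κ⁻¹ λ₀ : Carrier) (κ⁻¹κ≈1 : κ⁻¹ * κ ≈ 1#)
           (g-cong : Respects≈ g) (φ-cong : Respects≈ φ)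
           (φψ≈id : ∀ y → φ (ψ y) ≈ y) (φ-injective : ∀ a b → φ a ≈ φ b → a ≈ b)
           (relation : ∀ x → κ * f x ≈ λ₀ + g (φ x)) where

    relation-ψ : ∀ y → κ * f (ψ y) ≈ λ₀ + g y
    relation-ψ y = trans (relation (ψ y)) (+-congˡ (g-cong (φψ≈id y)))

    κκ⁻¹≈1 : κ * κ⁻¹ ≈ 1#
    κκ⁻¹≈1 = trans (*-comm _ _) κ⁻¹κ≈1

    f⇒g : IsPermutationPoly R f → IsPermutationPoly R g
    f⇒g (f-injective , f-surjective) = g-injective , g-surjective
      where
      g-injective : ∀ y₁ y₂ → g y₁ ≈ g y₂ → y₁ ≈ y₂
      g-injective y₁ y₂ gy₁≈gy₂ = begin
        y₁          ≈⟨ sym (φψ≈id y₁) ⟩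
        φ (ψ y₁)    ≈⟨ φ-cong (f-injective _ _ (*-cancelˡ κ κ⁻¹ _ _ κ⁻¹κ≈1 κf≈κf)) ⟩
        φ (ψ y₂)    ≈⟨ φψ≈id y₂ ⟩
        y₂          ∎
        where
        κf≈κf : κ * f (ψ y₁) ≈ κ * f (ψ y₂)
        κf≈κf = trans (relation-ψ y₁) (trans (+-congˡ gy₁≈gy₂) (sym (relation-ψ y₂)))
      g-surjective : ∀ z → ∃ λ y → g y ≈ z
      g-surjective z with f-surjective (κ⁻¹ * (λ₀ + z))
      ... | (x₀ , fx₀≈) = φ x₀ , +-cancelˡ λ₀ _ _ (begin
        λ₀ + g (φ x₀)          ≈⟨ sym (relation x₀) ⟩
        κ * f x₀               ≈⟨ *-congˡ fx₀≈ ⟩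
        κ * (κ⁻¹ * (λ₀ + z))   ≈⟨ sym (*-assoc _ _ _) ⟩
        (κ * κ⁻¹) * (λ₀ + z)   ≈⟨ *-congʳ κκ⁻¹≈1 ⟩
        1# * (λ₀ + z)          ≈⟨ *-identityˡ _ ⟩
        λ₀ + z                 ∎)

    g⇒f : IsPermutationPoly R g → IsPermutationPoly R f
    g⇒f (g-injective , g-surjective) = f-injective , f-surjective
      where
      f-injective : ∀ x₁ x₂ → f x₁ ≈ f x₂ → x₁ ≈ x₂
      f-injective x₁ x₂ fx₁≈fx₂ = φ-injective _ _ (g-injective _ _ (+-cancelˡ λ₀ _ _ (begin
        λ₀ + g (φ x₁)   ≈⟨ sym (relation x₁) ⟩
        κ * f x₁        ≈⟨ *-congˡ fx₁≈fx₂ ⟩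
        κ * f x₂        ≈⟨ relation x₂ ⟩
        λ₀ + g (φ x₂)   ∎)))
      f-surjective : ∀ z → ∃ λ x → f x ≈ z
      f-surjective z with g-surjective (κ * z - λ₀)
      ... | (y₀ , gy₀≈) = ψ y₀ , *-cancelˡ κ κ⁻¹ _ _ κ⁻¹κ≈1 (begin
        κ * f (ψ y₀)         ≈⟨ relation-ψ y₀ ⟩
        λ₀ + g y₀            ≈⟨ +-congˡ gy₀≈ ⟩
        λ₀ + (κ * z - λ₀)    ≈⟨ +-comm _ _ ⟩
        (κ * z - λ₀) + λ₀    ≈⟨ +-assoc _ _ _ ⟩
        κ * z + (- λ₀ + λ₀)  ≈⟨ +-congˡ (-‿inverseˡ λ₀) ⟩
        κ * z + 0#           ≈⟨ +-identityʳ _ ⟩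
        κ * z                ∎)

    permutation-transfer : IsPermutationPoly R f ⇔ IsPermutationPoly R g
    permutation-transfer = mk⇔ f⇒g g⇒f

-- The identity 2^n D_{n,k}(x) = (2 - k) + G(1 - 4x) for n = p^l₁ + p^l₂ + p^l₃ in
-- characteristic p: each p^l = 2δ + 1 is odd and w^{p^l} = 1 + t^δ s.
module DicksonAtPrimePowers {c ℓ : Level} (R : CommutativeRing c ℓ) (p : ℕ) (p-prime : Prime p)
                            (p-odd : OddNumbers.Odd p)
                            (char-p : CommutativeRing._≈_ R (natR R p) (CommutativeRing.0# R)) where
  open CommutativeRing R
  open IntegerCoefficients R using (ι)
  open OddNumbers using (odd-^)

  dickson-identity : ∀ k l₁ l₂ l₃ x →
    let n = p ℕ.^ l₁ ℕ.+ p ℕ.^ l₂ ℕ.+ p ℕ.^ l₃ in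
    pow R (ι 2) n * D R n k x ≈ (ι 2 - ι k) + G R k (p ℕ.^ l₁) (p ℕ.^ l₂) (p ℕ.^ l₃) (ι 1 - ι 4 * x)
  dickson-identity k l₁ l₂ l₃ x =
    ThreeTermIdentity.three-term-identity R k x δ₁ δ₂ δ₃ odd₁ odd₂ odd₃
      (w^odd-p^ l₁ δ₁ odd₁) (w^odd-p^ l₂ δ₂ odd₂) (w^odd-p^ l₃ δ₃ odd₃)
    where
    open PowersOfW R x p p-prime char-p using (w^odd-p^)
    δ₁ δ₂ δ₃ : ℕ
    δ₁ = proj₁ (odd-^ p p-odd l₁)
    δ₂ = proj₁ (odd-^ p p-odd l₂)
    δ₃ = proj₁ (odd-^ p p-odd l₃)
    odd₁ : p ℕ.^ l₁ ≡.≡ suc (2 ℕ.* δ₁)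
    odd₁ = proj₂ (odd-^ p p-odd l₁)
    odd₂ : p ℕ.^ l₂ ≡.≡ suc (2 ℕ.* δ₂)
    odd₂ = proj₂ (odd-^ p p-odd l₂)
    odd₃ : p ℕ.^ l₃ ≡.≡ suc (2 ℕ.* δ₃)
    odd₃ = proj₂ (odd-^ p p-odd l₃)

-- In a field of odd characteristic, 2 is a unit; hence so is 2^n, and x ↦ 1 - 4x
-- is a bijection.
module OddCharacteristic {c ℓ : Level} (R : CommutativeRing c ℓ) (fld : IsFieldRing R)
                         (p : ℕ) (p-odd : OddNumbers.Odd p)
                         (char-p : CommutativeRing._≈_ R (natR R p) (CommutativeRing.0# R)) where
  open CommutativeRing R
  open import Relation.Binary.Reasoning.Setoid setoid
  open import Algebra.Properties.Ring ring using (-‿involutive)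
  open IntegerCoefficients R using (ι; ι-*; solve; _:=_; _:-_)
  open FieldFacts R fld using (inverse; nonzero-*; nonzero-pow)
  open Congruence R using (Respects≈)
  open PermutationTransfer R using (+-cancelˡ; *-cancelˡ; permutation-transfer)

  -- p = 2δ + 1 and p = 0 give 1 = -2δ, so 2 = 0 would force 1 = 0
  two-nonzero : ¬ (ι 2 ≈ 0#)
  two-nonzero 2≈0 = proj₁ fld (begin
    0#                   ≈⟨ sym char-p ⟩
    ι p                  ≡⟨ ≡.cong ι (proj₂ p-odd) ⟩
    1# + ι (2 ℕ.* δ)     ≈⟨ +-congˡ (ι-* 2 δ) ⟩
    1# + ι 2 * ι δ       ≈⟨ +-congˡ (trans (*-congʳ 2≈0) (zeroˡ _)) ⟩
    1# + 0#              ≈⟨ +-identityʳ 1# ⟩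
    1#                   ∎)
    where δ = proj₁ p-odd

  four-nonzero : ¬ (ι 4 ≈ 0#)
  four-nonzero 4≈0 = nonzero-* (ι 2) (ι 2) two-nonzero two-nonzero (trans (sym (ι-* 2 2)) 4≈0)

  ¼ : Carrier
  ¼ = proj₁ (inverse (ι 4) four-nonzero)

  substitute unsubstitute : Carrier → Carrier
  substitute x = ι 1 - ι 4 * x
  unsubstitute y = ¼ * (ι 1 - y)

  substitute-cong : Respects≈ substitute
  substitute-cong a≈b = +-congˡ (-‿cong (*-congˡ a≈b))

  substitute-unsubstitute : ∀ y → substitute (unsubstitute y) ≈ y
  substitute-unsubstitute y = begin
    ι 1 - ι 4 * (¼ * (ι 1 - y))   ≈⟨ +-congˡ (-‿cong (sym (*-assoc _ _ _))) ⟩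
    ι 1 - (ι 4 * ¼) * (ι 1 - y)   ≈⟨ +-congˡ (-‿cong (*-congʳ (trans (*-comm _ _) (proj₂ (inverse (ι 4) four-nonzero))))) ⟩
    ι 1 - 1# * (ι 1 - y)          ≈⟨ +-congˡ (-‿cong (*-identityˡ _)) ⟩
    ι 1 - (ι 1 - y)               ≈⟨ double-difference _ _ ⟩
    y                             ∎
    where
    double-difference : ∀ a y → a - (a - y) ≈ y
    double-difference = solve 2 (λ a y → (a :- (a :- y)) := y) refl

  substitute-injective : ∀ a b → substitute a ≈ substitute b → a ≈ b
  substitute-injective a b eq = *-cancelˡ (ι 4) ¼ a b (proj₂ (inverse (ι 4) four-nonzero))
    (trans (sym (-‿involutive _)) (trans (-‿cong (+-cancelˡ (ι 1) _ _ eq)) (-‿involutive _)))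

  transfer-along-substitution : ∀ n (f g : Carrier → Carrier) (λ₀ : Carrier) → Respects≈ g →
    (∀ x → pow R (ι 2) n * f x ≈ λ₀ + g (substitute x)) → IsPermutationPoly R f ⇔ IsPermutationPoly R g
  transfer-along-substitution n f g λ₀ g-cong relation =
    permutation-transfer f g substitute unsubstitute (pow R (ι 2) n) (proj₁ unit) λ₀ (proj₂ unit)
      g-cong substitute-cong substitute-unsubstitute substitute-injective relation
    where unit = inverse (pow R (ι 2) n) (nonzero-pow (ι 2) two-nonzero n)

mainTheorem8 : {c ℓ : Level} (p e k l₁ l₂ l₃ : ℕ) → Prime p → ¬ (p ≡.≡ 2) → 1 ℕ.≤ e → k ℕ.< p →
    (R : CommutativeRing c ℓ) → IsFieldRing R → HasCard R (p ℕ.^ e) →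
    IsPermutationPoly R (D R (p ℕ.^ l₁ ℕ.+ p ℕ.^ l₂ ℕ.+ p ℕ.^ l₃) k)
      ⇔ IsPermutationPoly R (G R k (p ℕ.^ l₁) (p ℕ.^ l₂) (p ℕ.^ l₃))
mainTheorem8 p e k l₁ l₂ l₃ p-prime p≢2 _ _ R fld card =
  transfer-along-substitution (p ℕ.^ l₁ ℕ.+ p ℕ.^ l₂ ℕ.+ p ℕ.^ l₃)
    (D R (p ℕ.^ l₁ ℕ.+ p ℕ.^ l₂ ℕ.+ p ℕ.^ l₃) k) (G R k (p ℕ.^ l₁) (p ℕ.^ l₂) (p ℕ.^ l₃))
    (natR R 2 - natR R k) (G-cong k (p ℕ.^ l₁) (p ℕ.^ l₂) (p ℕ.^ l₃))
    (dickson-identity k l₁ l₂ l₃)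
  where
  open CommutativeRing R using (_≈_; _-_; 0#)
  open Congruence R using (G-cong)

  p-odd : OddNumbers.Odd p
  p-odd = OddNumbers.odd-prime p p-prime p≢2

  char-p : natR R p ≈ 0#
  char-p = FiniteRing.char-of-order R (p ℕ.^ e) card fld p e ≡.refl

  open OddCharacteristic R fld p p-odd char-p using (transfer-along-substitution)
  open DicksonAtPrimePowers R p p-prime p-odd char-p using (dickson-identity)
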